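{- Let $\bm{\beta}=(\beta^{(1)},\ldots,\beta^{(k)})$ be a tuple of partitions and let $m(\bm{\beta})$ be the total number of triples of $\bm{\beta}$. Then \[m(\bm{\beta})=\#\{(a,b,i,j): a<b,\ 0\le\beta^{(b)}_j-j+i<\beta^{(a)}_i\}+\sum_{a<b}\sum_{i,j}\max\!\left(\min(\beta^{(a)}_i-i,\ \beta^{(b)}_j-j)+\min(i,j),\ 0\right),\] where $i$ ranges over the row indices $1,\ldots,p_a$ of $\beta^{(a)}$ and $j$ over the row indices $1,\ldots,p_b$ of $\beta^{(b)}$.
   Context: Partitions have a fixed number of parts (zero parts allowed); $\beta^{(a)}$ has $p_a$ parts. Cells are $(r,c)\in\mathbb{Z}^2$ (row $r$, column $c$); $\beta^{(a)}$ consists of cells $(r,c)$ with $1\le r\le p_a$, $1\le c\le\beta^{(a)}_r$; the content of $(r,c)$ is $c-r$. A triple of $\bm{\beta}$ (viewed as the skew tuple $\bm{\beta}/\bm{0}$ with $\bm 0$ the all-zero partitions of the same numbers of parts) is a triple of cells $(u,v,w)$ such that for some $a<b$: $v$ is a cell of $\beta^{(a)}$, and $u=(r,c-1)$, $w=(r,c)$ with $1\le r\le p_b$, $w$ of the same content as $v$, $c-1\ge 0$ and $c\le\beta^{(b)}_r+1$. -}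

module Defs where

open import Data.Nat as ℕ using (ℕ; zero; suc)
open import Data.Integer as ℤ using (ℤ; +_; _-_; _⊓_; _⊔_)
open import Data.Integer.Properties as ℤP using ()
open import Data.Fin as F using (Fin; toℕ)
open import Data.Fin.Properties as FP using ()
open import Data.Vec using (Vec; lookup)
open import Data.Product using (Σ; Σ-syntax; _×_; _,_)
open import Data.Bool using (if_then_else_)
open import Relation.Nullary.Decidable using (⌊_⌋; _×-dec_)
open import Relation.Binary.PropositionalEquality using (_≡_)

IsPartition : {p : ℕ} → Vec ℕ p → Set
IsPartition {p} λ' = (i j : Fin p) → i F.≤ j → lookup λ' j ℕ.≤ lookup λ' i

Tuple : (k : ℕ) → (p : Fin k → ℕ) → Set
Tuple k p = (a : Fin k) → Vec ℕ (p a)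

-- Cells (r , c) ∈ ℤ², row r, column c.
Cell : Set
Cell = ℤ × ℤ

content : Cell → ℤ
content (r , c) = c - r

-- 1-based row index of i : Fin p
row : {p : ℕ} → Fin p → ℤ
row i = + suc (toℕ i)

IsCellOf : {p : ℕ} → Vec ℕ p → Cell → Set
IsCellOf {p} λ' (r , c) =
  Σ[ i ∈ Fin p ] (r ≡ row i × (+ 1 ℤ.≤ c × c ℤ.≤ + lookup λ' i))

IsTriple : {k : ℕ} {p : Fin k → ℕ} → Tuple k p →
           Fin k → Fin k → Cell → Cell → Cell → Set
IsTriple {k} {p} β a b u v w =
  a F.< b × IsCellOf (β a) v ×
  Σ[ j ∈ Fin (p b) ] Σ[ c ∈ ℤ ]
    ( u ≡ (row j , c - + 1) × w ≡ (row j , c)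
    × content w ≡ content v
    × + 0 ℤ.≤ c - + 1
    × c ℤ.≤ + lookup (β b) j ℤ.+ + 1 )

Triples : {k : ℕ} {p : Fin k → ℕ} → Tuple k p → Set
Triples {k} β = Σ[ a ∈ Fin k ] Σ[ b ∈ Fin k ] Σ[ u ∈ Cell ] Σ[ v ∈ Cell ] Σ[ w ∈ Cell ]
                  IsTriple β a b u v w

sumFin : (n : ℕ) → (Fin n → ℤ) → ℤ
sumFin zero f = + 0
sumFin (suc n) f = f F.zero ℤ.+ sumFin n (λ i → f (F.suc i))

sumPairs : (k : ℕ) → (Fin k → Fin k → ℤ) → ℤ
sumPairs k f = sumFin k (λ a → sumFin k (λ b → if ⌊ a F.<? b ⌋ then f a b else + 0))

countTerm : {k : ℕ} {p : Fin k → ℕ} → Tuple k p → ℤ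
countTerm {k} {p} β = sumPairs k (λ a b → sumFin (p a) (λ i → sumFin (p b) (λ j →
  let x = + lookup (β b) j - row j ℤ.+ row i in
  if ⌊ (+ 0 ℤP.≤? x) ×-dec (x ℤP.<? + lookup (β a) i) ⌋ then + 1 else + 0)))

maxTerm : {k : ℕ} {p : Fin k → ℕ} → Tuple k p → ℤ
maxTerm {k} {p} β = sumPairs k (λ a b → sumFin (p a) (λ i → sumFin (p b) (λ j →
  (((+ lookup (β a) i - row i) ⊓ (+ lookup (β b) j - row j)) ℤ.+ (row i ⊓ row j)) ⊔ + 0)))

-- The content condition forces the column of u and w: a triple is determined by the pair
-- a < b, the rows i of β^(a) and j of β^(b), and the column of v, and for fixed (a, b, i, j)
-- the admissible columns of v form an interval of integers.  Writing A = β^(a)_i,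
-- B = β^(b)_j and s = i − j, its length is max(0, min(X, Y + 1)) with X = A − max(0, s) and
-- Y = B + s − max(0, s), while min(A − i, B − j) + min(i, j) = min(X, Y) and, as B ≥ 0,
-- [0 ≤ Y < X] = [0 ≤ B − j + i < A].  The identity
-- max(0, min(X, Y + 1)) = [0 ≤ Y < X] + max(0, min(X, Y)) then splits each interval length
-- into the two summands of the formula.  The partitions need not be weakly decreasing.
module Submission where

open import Defs
open import Data.Nat as ℕ using (ℕ; zero; suc)
open import Data.Integer as ℤ using (ℤ; +_; _+_; _-_; -_; _⊓_; _⊔_; _≤_; _<_; ∣_∣; +≤+; +<+)
open import Data.Integer.Properties
open import Data.Integer.Tactic.RingSolver using (solve-∀)
open import Data.Fin as F using (Fin; toℕ; fromℕ<)
import Data.Fin.Properties as FP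
open import Data.Vec using (lookup)
open import Data.Product using (Σ; Σ-syntax; ∃-syntax; _×_; _,_; proj₂)
open import Data.Product.Properties using (Σ-≡,≡→≡)
open import Data.Sum using (_⊎_; inj₁; inj₂)
open import Data.Sum.Function.Propositional using (_⊎-↔_)
open import Data.Bool using (Bool; true; false; if_then_else_)
open import Data.Empty using (⊥-elim)
open import Function using (_∘_)
open import Function.Bundles using (_↔_; _⇔_; mk↔ₛ′; mk⇔; Equivalence)
open import Function.Properties.Inverse using (↔-trans; ↔-sym)
open import Relation.Nullary using (Dec; yes; no)
open import Relation.Nullary.Decidable using (⌊_⌋; _×-dec_)
open import Relation.Nullary.Irrelevant using (Irrelevant)
open import Relation.Binary.PropositionalEquality
import Axiom.UniquenessOfIdentityProofs as UIP

i-j+j≡i : ∀ i j → i - j + j ≡ i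
i-j+j≡i = solve-∀

i+j-j≡i : ∀ i j → i + j - j ≡ i
i+j-j≡i = solve-∀

i≤j⇒i<j+1 : ∀ {i j} → i ≤ j → i < j + + 1
i≤j⇒i<j+1 {i} {j} i≤j = suc[i]≤j⇒i<j (subst (ℤ.suc i ≤_) (+-comm (+ 1) j) (suc-mono i≤j))

i<j⇒i+1≤j : ∀ {i j} → i < j → i + + 1 ≤ j
i<j⇒i+1≤j {i} {j} i<j = subst (_≤ j) (+-comm (+ 1) i) (i<j⇒suc[i]≤j i<j)

i<j+1⇒i≤j : ∀ {i j} → i < j + + 1 → i ≤ j
i<j+1⇒i≤j {i} {j} i<j+1 =
  subst₂ _≤_ (1+i-1≡i i) (i+j-j≡i j (+ 1)) (+-monoˡ-≤ (- + 1) (i<j⇒suc[i]≤j i<j+1))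
  where
  1+i-1≡i : ∀ i → + 1 + i - + 1 ≡ i
  1+i-1≡i = solve-∀

+-cancelʳ-≤ : ∀ k {i j} → i + k ≤ j + k → i ≤ j
+-cancelʳ-≤ k {i} {j} le = subst₂ _≤_ (i+j-j≡i i k) (i+j-j≡i j k) (+-monoˡ-≤ (- k) le)

+-distribʳ-⊓ : ∀ k i j → (i ⊓ j) + k ≡ (i + k) ⊓ (j + k)
+-distribʳ-⊓ k = mono-≤-distrib-⊓ (+-monoˡ-≤ k)

⊓-+1≡⊓ : ∀ {X Y} → X ≤ Y → X ⊓ (Y + + 1) ≡ X ⊓ Y
⊓-+1≡⊓ X≤Y = trans (i≤j⇒i⊓j≡i (<⇒≤ (i≤j⇒i<j+1 X≤Y))) (sym (i≤j⇒i⊓j≡i X≤Y))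

indicator : ∀ {P : Set} → Dec P → ℤ
indicator P? = if ⌊ P? ⌋ then + 1 else + 0

indicator-cong : ∀ {P Q : Set} → P ⇔ Q → (P? : Dec P) (Q? : Dec Q) → indicator P? ≡ indicator Q?
indicator-cong _   (yes _) (yes _) = refl
indicator-cong P⇔Q (yes p) (no ¬q) = ⊥-elim (¬q (Equivalence.to P⇔Q p))
indicator-cong P⇔Q (no ¬p) (yes q) = ⊥-elim (¬p (Equivalence.from P⇔Q q))
indicator-cong _   (no _)  (no _)  = refl

⊓-+1-⊔0 : ∀ X Y → (X ⊓ (Y + + 1)) ⊔ + 0 ≡
          indicator ((+ 0 ≤? Y) ×-dec (Y <? X)) + ((X ⊓ Y) ⊔ + 0)
⊓-+1-⊔0 X Y with + 0 ≤? Y | Y <? X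
... | yes 0≤Y | yes Y<X = begin
  (X ⊓ (Y + + 1)) ⊔ + 0  ≡⟨ cong (_⊔ + 0) (i≥j⇒i⊓j≡j (i<j⇒i+1≤j Y<X)) ⟩
  (Y + + 1) ⊔ + 0        ≡⟨ i≥j⇒i⊔j≡i (<⇒≤ (i≤j⇒i<j+1 0≤Y)) ⟩
  Y + + 1                ≡⟨ +-comm Y (+ 1) ⟩
  + 1 + Y                ≡⟨ cong (_+_ (+ 1)) (sym (i≥j⇒i⊔j≡i 0≤Y)) ⟩
  + 1 + (Y ⊔ + 0)        ≡⟨ cong (λ z → + 1 + (z ⊔ + 0)) (sym (i≥j⇒i⊓j≡j (<⇒≤ Y<X))) ⟩
  + 1 + ((X ⊓ Y) ⊔ + 0)  ∎
  where open ≡-Reasoning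
... | no 0≰Y  | yes Y<X = begin
  (X ⊓ (Y + + 1)) ⊔ + 0  ≡⟨ cong (_⊔ + 0) (i≥j⇒i⊓j≡j (i<j⇒i+1≤j Y<X)) ⟩
  (Y + + 1) ⊔ + 0        ≡⟨ i≤j⇒i⊔j≡j (i<j⇒i+1≤j (≰⇒> 0≰Y)) ⟩
  + 0                    ≡⟨ sym (i≤j⇒i⊔j≡j (≤-trans (i⊓j≤j X Y) (<⇒≤ (≰⇒> 0≰Y)))) ⟩
  (X ⊓ Y) ⊔ + 0          ≡⟨ sym (+-identityˡ _) ⟩
  + 0 + ((X ⊓ Y) ⊔ + 0)  ∎
  where open ≡-Reasoning
... | yes _   | no Y≮X  = trans (cong (_⊔ + 0) (⊓-+1≡⊓ (≮⇒≥ Y≮X))) (sym (+-identityˡ _))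
... | no _    | no Y≮X  = trans (cong (_⊔ + 0) (⊓-+1≡⊓ (≮⇒≥ Y≮X))) (sym (+-identityˡ _))

×-irrelevant : ∀ {P Q : Set} → Irrelevant P → Irrelevant Q → Irrelevant (P × Q)
×-irrelevant irrP irrQ (p , q) (p′ , q′) = cong₂ _,_ (irrP p p′) (irrQ q q′)

≤≤-irrelevant : ∀ {lo hi x} → Irrelevant (lo ≤ x × x ≤ hi)
≤≤-irrelevant = ×-irrelevant ≤-irrelevant ≤-irrelevant

ℤ-≡-irrelevant : ∀ {i j : ℤ} → Irrelevant (i ≡ j)
ℤ-≡-irrelevant = UIP.Decidable⇒UIP.≡-irrelevant ℤ._≟_

Σ-↔-⇔ : ∀ {A : Set} {P R : A → Set} → (∀ {x} → Irrelevant (P x)) → (∀ {x} → Irrelevant (R x)) →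
        (∀ {x} → P x ⇔ R x) → Σ A P ↔ Σ A R
Σ-↔-⇔ irrP irrR P⇔R = mk↔ₛ′
  (λ (x , p) → x , Equivalence.to P⇔R p) (λ (x , r) → x , Equivalence.from P⇔R r)
  (λ _ → Σ-≡,≡→≡ (refl , irrR _ _)) (λ _ → Σ-≡,≡→≡ (refl , irrP _ _))

Σ-Fin-suc↔ : ∀ {n} (T : Fin (suc n) → Set) →
             Σ (Fin (suc n)) T ↔ (T F.zero ⊎ Σ (Fin n) (T ∘ F.suc))
Σ-Fin-suc↔ {n} T = mk↔ₛ′ to from to∘from from∘to
  where
  to : Σ (Fin (suc n)) T → T F.zero ⊎ Σ (Fin n) (T ∘ F.suc)
  to (F.zero  , t) = inj₁ t
  to (F.suc i , t) = inj₂ (i , t)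
  from : T F.zero ⊎ Σ (Fin n) (T ∘ F.suc) → Σ (Fin (suc n)) T
  from (inj₁ t)       = F.zero , t
  from (inj₂ (i , t)) = F.suc i , t
  to∘from : ∀ y → to (from y) ≡ y
  to∘from (inj₁ t)       = refl
  to∘from (inj₂ (i , t)) = refl
  from∘to : ∀ x → from (to x) ≡ x
  from∘to (F.zero  , t) = refl
  from∘to (F.suc i , t) = refl

Counted : Set → ℤ → Set
Counted X z = ∃[ m ] ((Fin m ↔ X) × (+ m ≡ z))

counted-↔ : ∀ {X Y z} → X ↔ Y → Counted X z → Counted Y z
counted-↔ X↔Y (m , e , eq) = m , ↔-trans e X↔Y , eq

counted-≡ : ∀ {X z z′} → z ≡ z′ → Counted X z → Counted X z′
counted-≡ refl c = c

counted-⊎ : ∀ {X Y x y} → Counted X x → Counted Y y → Counted (X ⊎ Y) (x + y)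
counted-⊎ (m , e , refl) (n , f , refl) = m ℕ.+ n , ↔-trans FP.+↔⊎ (e ⊎-↔ f) , pos-+ m n

counted-Σ-Fin : ∀ n {T : Fin n → Set} {f : Fin n → ℤ} →
                (∀ i → Counted (T i) (f i)) → Counted (Σ (Fin n) T) (sumFin n f)
counted-Σ-Fin zero    _ = 0 , mk↔ₛ′ (λ ()) (λ { (() , _) }) (λ { (() , _) }) (λ ()) , refl
counted-Σ-Fin (suc n) {T} c =
  counted-↔ (↔-sym (Σ-Fin-suc↔ T)) (counted-⊎ (c F.zero) (counted-Σ-Fin n (c ∘ F.suc)))

counted-guard : ∀ {P X z} (P? : Dec P) → Irrelevant P → Counted X z →
                Counted (P × X) (if ⌊ P? ⌋ then z else + 0)
counted-guard (yes p) irr (m , e , eq) =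
  m , ↔-trans e (mk↔ₛ′ (p ,_) proj₂ (λ { (q , x) → cong (_, x) (irr p q) }) (λ _ → refl)) , eq
counted-guard (no ¬p) _ _ =
  0 , mk↔ₛ′ (λ ()) (λ (p , _) → ⊥-elim (¬p p)) (λ (p , _) → ⊥-elim (¬p p)) (λ ()) , refl

offsets↔interval : ∀ lo n → Fin n ↔ (Σ[ x ∈ ℤ ] (lo ≤ x × x < + n + lo))
offsets↔interval lo n = mk↔ₛ′ to from to∘from from∘to
  where
  offset≡ : ∀ {x} → lo ≤ x → + ∣ x - lo ∣ ≡ x - lo
  offset≡ lo≤x = 0≤i⇒+∣i∣≡i (i≤j⇒0≤j-i lo≤x)
  to : Fin n → Σ[ x ∈ ℤ ] (lo ≤ x × x < + n + lo)
  to k = + toℕ k + lo , i≤j⇒i≤k+j (+ toℕ k) ≤-refl , +-monoˡ-< lo (+<+ (FP.toℕ<n k))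
  from : Σ[ x ∈ ℤ ] (lo ≤ x × x < + n + lo) → Fin n
  from (x , lo≤x , x<n+lo) = fromℕ< (drop‿+<+ (subst₂ _<_ (sym (offset≡ lo≤x)) (i+j-j≡i (+ n) lo)
                                                       (+-monoˡ-< (- lo) x<n+lo)))
  to∘from : ∀ y → to (from y) ≡ y
  to∘from (x , lo≤x , _) = Σ-≡,≡→≡ (x≡ , ×-irrelevant ≤-irrelevant <-irrelevant _ _)
    where
    x≡ : + toℕ (fromℕ< _) + lo ≡ x
    x≡ = trans (cong (λ k → + k + lo) (FP.toℕ-fromℕ< _))
               (trans (cong (_+ lo) (offset≡ lo≤x)) (i-j+j≡i x lo))
  from∘to : ∀ k → from (to k) ≡ k
  from∘to k = FP.toℕ-injective (trans (FP.toℕ-fromℕ< _) (cong ∣_∣ (i+j-j≡i (+ toℕ k) lo)))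

counted-interval : ∀ lo hi → Counted (Σ[ x ∈ ℤ ] (lo ≤ x × x ≤ hi)) ((hi + + 1 - lo) ⊔ + 0)
counted-interval lo hi with lo ≤? hi
... | yes lo≤hi =
  ∣ len ∣ ,
  ↔-trans (offsets↔interval lo ∣ len ∣)
          (Σ-↔-⇔ (×-irrelevant ≤-irrelevant <-irrelevant) ≤≤-irrelevant
                 (mk⇔ (λ (p , q) → p , i<j+1⇒i≤j (subst (_ <_) n+lo≡ q))
                      (λ (p , q) → p , subst (_ <_) (sym n+lo≡) (i≤j⇒i<j+1 q)))) ,
  trans +∣len∣≡len (sym (i≥j⇒i⊔j≡i 0≤len))
  where
  len : ℤ
  len = hi + + 1 - lo
  0≤len : + 0 ≤ len
  0≤len = i≤j⇒0≤j-i (<⇒≤ (i≤j⇒i<j+1 lo≤hi))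
  +∣len∣≡len : + ∣ len ∣ ≡ len
  +∣len∣≡len = 0≤i⇒+∣i∣≡i 0≤len
  n+lo≡ : + ∣ len ∣ + lo ≡ hi + + 1
  n+lo≡ = trans (cong (_+ lo) +∣len∣≡len) (i-j+j≡i (hi + + 1) lo)
... | no lo≰hi =
  0 , mk↔ₛ′ (λ ()) (λ (_ , lo≤x , x≤hi) → ⊥-elim (lo≰hi (≤-trans lo≤x x≤hi)))
               (λ (_ , lo≤x , x≤hi) → ⊥-elim (lo≰hi (≤-trans lo≤x x≤hi))) (λ ()) ,
  sym (i≤j⇒i⊔j≡j (i≤j⇒i-j≤0 (i<j⇒i+1≤j (≰⇒> lo≰hi))))

-- The columns cv of v in row I (of length A) of β^(a) that complete to a triple with u, w in
-- row J (of length B) of β^(b); c is the column of w.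
MatchingColumn : ℕ → ℕ → ℤ → ℤ → ℤ → Set
MatchingColumn A B I J cv =
  (+ 1 ≤ cv × cv ≤ + A) × Σ[ c ∈ ℤ ] (c - J ≡ cv - I × + 0 ≤ c - + 1 × c ≤ + B + + 1)

firstMatchingColumn : ℤ → ℤ → ℤ
firstMatchingColumn I J = + 1 ⊔ (+ 1 + (I - J))

lastMatchingColumn : ℕ → ℕ → ℤ → ℤ → ℤ
lastMatchingColumn A B I J = + A ⊓ (+ B + + 1 + (I - J))

matchingColumn-irrelevant : ∀ {A B I J cv} → Irrelevant (MatchingColumn A B I J cv)
matchingColumn-irrelevant {A} {B} {I} {J} {cv}
  (cv-range , c , e , c-range) (cv-range′ , c′ , e′ , c-range′)
  with trans (sym (i-j+j≡i c J)) (trans (cong (_+ J) (trans e (sym e′))) (i-j+j≡i c′ J))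
... | refl = cong₂ _,_ (≤≤-irrelevant cv-range cv-range′)
                       (cong (c ,_) (rest-irrelevant (e , c-range) (e′ , c-range′)))
  where
  rest-irrelevant : Irrelevant (c - J ≡ cv - I × + 0 ≤ c - + 1 × c ≤ + B + + 1)
  rest-irrelevant = ×-irrelevant ℤ-≡-irrelevant (×-irrelevant ≤-irrelevant ≤-irrelevant)

matchingColumn⇔interval : ∀ {A B I J cv} →
  MatchingColumn A B I J cv ⇔ (firstMatchingColumn I J ≤ cv × cv ≤ lastMatchingColumn A B I J)
matchingColumn⇔interval {A} {B} {I} {J} {cv} = mk⇔ to from
  where
  s : ℤ
  s = I - J
  Bounds : Set
  Bounds = firstMatchingColumn I J ≤ cv × cv ≤ lastMatchingColumn A B I J
  c+s≡cv : ∀ c → c - J ≡ cv - I → c + s ≡ cv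
  c+s≡cv c e = trans (reassoc c I J) (trans (cong (_+ I) e) (i-j+j≡i cv I))
    where
    reassoc : ∀ c I J → c + (I - J) ≡ c - J + I
    reassoc = solve-∀
  to : MatchingColumn A B I J cv → Bounds
  to ((1≤cv , cv≤A) , c , e , 0≤c-1 , c≤B+1) =
    ⊔-lub 1≤cv (subst (+ 1 + s ≤_) (c+s≡cv c e) (+-monoˡ-≤ s (0≤i-j⇒j≤i {c} {+ 1} 0≤c-1))) ,
    ⊓-glb cv≤A (subst (_≤ + B + + 1 + s) (c+s≡cv c e) (+-monoˡ-≤ s c≤B+1))
  from : Bounds → MatchingColumn A B I J cv
  from (first≤cv , cv≤last) =
    (≤-trans (i≤i⊔j (+ 1) _) first≤cv , ≤-trans cv≤last (i⊓j≤i (+ A) _)) ,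
    cv - s , content≡ cv I J ,
    i≤j⇒0≤j-i {+ 1} {cv - s}
      (+-cancelʳ-≤ s (subst (+ 1 + s ≤_) (sym c+s≡) (≤-trans (i≤j⊔i (+ 1) _) first≤cv))) ,
    +-cancelʳ-≤ s {cv - s} (subst (_≤ + B + + 1 + s) (sym c+s≡) (≤-trans cv≤last (i⊓j≤j (+ A) _)))
    where
    content≡ : ∀ cv I J → cv - (I - J) - J ≡ cv - I
    content≡ = solve-∀
    c+s≡ : cv - s + s ≡ cv
    c+s≡ = i-j+j≡i cv s

matchingColumnCount : ℕ → ℕ → ℤ → ℤ → ℤ
matchingColumnCount A B I J = (lastMatchingColumn A B I J + + 1 - firstMatchingColumn I J) ⊔ + 0

counted-matchingColumns : ∀ A B I J →
                          Counted (Σ ℤ (MatchingColumn A B I J)) (matchingColumnCount A B I J)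
counted-matchingColumns A B I J =
  counted-↔ (↔-sym (Σ-↔-⇔ matchingColumn-irrelevant ≤≤-irrelevant matchingColumn⇔interval))
            (counted-interval (firstMatchingColumn I J) (lastMatchingColumn A B I J))

formulaTerm : ℕ → ℕ → ℤ → ℤ → ℤ
formulaTerm A B I J =
  indicator ((+ 0 ≤? + B - J + I) ×-dec (+ B - J + I <? + A))
    + ((((+ A - I) ⊓ (+ B - J)) + (I ⊓ J)) ⊔ + 0)

matchingColumnCount≡formulaTerm-≤ : ∀ A B {I J} → I ≤ J →
                                    matchingColumnCount A B I J ≡ formulaTerm A B I J
matchingColumnCount≡formulaTerm-≤ A B {I} {J} I≤J = begin
  (last + + 1 - first) ⊔ + 0        ≡⟨ cong (λ f → (last + + 1 - f) ⊔ + 0) first≡1 ⟩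
  (last + + 1 - + 1) ⊔ + 0          ≡⟨ cong (_⊔ + 0) (i+j-j≡i last (+ 1)) ⟩
  last ⊔ + 0                        ≡⟨ cong (λ y → (+ A ⊓ y) ⊔ + 0) (bound≡ (+ B) I J) ⟩
  (+ A ⊓ (Y + + 1)) ⊔ + 0           ≡⟨ ⊓-+1-⊔0 (+ A) Y ⟩
  indicator Y? + ((+ A ⊓ Y) ⊔ + 0)  ≡⟨ cong (λ z → indicator Y? + (z ⊔ + 0)) (sym min≡) ⟩
  formulaTerm A B I J               ∎
  where
  open ≡-Reasoning
  first : ℤ
  first = firstMatchingColumn I J
  last : ℤ
  last = lastMatchingColumn A B I J
  Y : ℤ
  Y = + B - J + I
  Y? : Dec (+ 0 ≤ Y × Y < + A)
  Y? = (+ 0 ≤? Y) ×-dec (Y <? + A)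
  first≡1 : first ≡ + 1
  first≡1 = i≥j⇒i⊔j≡i (+-monoʳ-≤ (+ 1) (i≤j⇒i-j≤0 I≤J))
  bound≡ : ∀ b i j → b + + 1 + (i - j) ≡ b - j + i + + 1
  bound≡ = solve-∀
  min≡ : ((+ A - I) ⊓ (+ B - J)) + (I ⊓ J) ≡ + A ⊓ Y
  min≡ = begin
    ((+ A - I) ⊓ (+ B - J)) + (I ⊓ J)  ≡⟨ cong (_+_ ((+ A - I) ⊓ (+ B - J))) (i≤j⇒i⊓j≡i I≤J) ⟩
    ((+ A - I) ⊓ (+ B - J)) + I        ≡⟨ +-distribʳ-⊓ I (+ A - I) (+ B - J) ⟩
    (+ A - I + I) ⊓ Y                  ≡⟨ cong (_⊓ Y) (i-j+j≡i (+ A) I) ⟩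
    + A ⊓ Y                            ∎

matchingColumnCount≡formulaTerm-≥ : ∀ A B {I J} → J ≤ I →
                                    matchingColumnCount A B I J ≡ formulaTerm A B I J
matchingColumnCount≡formulaTerm-≥ A B {I} {J} J≤I = begin
  (last + + 1 - first) ⊔ + 0                ≡⟨ cong (λ f → (last + + 1 - f) ⊔ + 0) first≡1+s ⟩
  (last + + 1 - (+ 1 + s)) ⊔ + 0            ≡⟨ cong (_⊔ + 0) (shift≡ last s) ⟩
  (last - s) ⊔ + 0                          ≡⟨ cong (_⊔ + 0) last-s≡ ⟩
  ((+ A - s) ⊓ (+ B + + 1)) ⊔ + 0           ≡⟨ ⊓-+1-⊔0 (+ A - s) (+ B) ⟩
  indicator B? + (((+ A - s) ⊓ + B) ⊔ + 0)  ≡⟨ cong₂ (λ d z → d + (z ⊔ + 0)) (indicator-cong B⇔Y B? Y?)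
                                                                          (sym min≡) ⟩
  formulaTerm A B I J                       ∎
  where
  open ≡-Reasoning
  first : ℤ
  first = firstMatchingColumn I J
  last : ℤ
  last = lastMatchingColumn A B I J
  s : ℤ
  s = I - J
  Y : ℤ
  Y = + B - J + I
  Y? : Dec (+ 0 ≤ Y × Y < + A)
  Y? = (+ 0 ≤? Y) ×-dec (Y <? + A)
  B? : Dec (+ 0 ≤ + B × + B < + A - s)
  B? = (+ 0 ≤? + B) ×-dec (+ B <? + A - s)
  0≤s : + 0 ≤ s
  0≤s = i≤j⇒0≤j-i J≤I
  first≡1+s : first ≡ + 1 + s
  first≡1+s = i≤j⇒i⊔j≡j (+-monoʳ-≤ (+ 1) 0≤s)
  shift≡ : ∀ l s → l + + 1 - (+ 1 + s) ≡ l - s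
  shift≡ = solve-∀
  last-s≡ : last - s ≡ (+ A - s) ⊓ (+ B + + 1)
  last-s≡ = trans (+-distribʳ-⊓ (- s) (+ A) (+ B + + 1 + s))
                  (cong ((+ A - s) ⊓_) (i+j-j≡i (+ B + + 1) s))
  Y≡B+s : Y ≡ + B + s
  Y≡B+s = reassoc (+ B) I J
    where
    reassoc : ∀ b i j → b - j + i ≡ b + (i - j)
    reassoc = solve-∀
  B⇔Y : (+ 0 ≤ + B × + B < + A - s) ⇔ (+ 0 ≤ Y × Y < + A)
  B⇔Y = mk⇔
    (λ (0≤B , B<A-s) → subst (+ 0 ≤_) (sym Y≡B+s) (+-mono-≤ 0≤B 0≤s) ,
                       subst₂ _<_ (sym Y≡B+s) (i-j+j≡i (+ A) s) (+-monoˡ-< s B<A-s))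
    (λ (_ , Y<A) → +≤+ ℕ.z≤n ,
                   subst (_< + A - s) (trans (cong (_- s) Y≡B+s) (i+j-j≡i (+ B) s))
                         (+-monoˡ-< (- s) Y<A))
  min≡ : ((+ A - I) ⊓ (+ B - J)) + (I ⊓ J) ≡ (+ A - s) ⊓ + B
  min≡ = begin
    ((+ A - I) ⊓ (+ B - J)) + (I ⊓ J)  ≡⟨ cong (_+_ ((+ A - I) ⊓ (+ B - J))) (i≥j⇒i⊓j≡j J≤I) ⟩
    ((+ A - I) ⊓ (+ B - J)) + J        ≡⟨ +-distribʳ-⊓ J (+ A - I) (+ B - J) ⟩
    (+ A - I + J) ⊓ (+ B - J + J)      ≡⟨ cong₂ _⊓_ (reassoc (+ A) I J) (i-j+j≡i (+ B) J) ⟩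
    (+ A - s) ⊓ + B                    ∎
    where
    reassoc : ∀ a i j → a - i + j ≡ a - (i - j)
    reassoc = solve-∀

matchingColumnCount≡formulaTerm : ∀ A B I J → matchingColumnCount A B I J ≡ formulaTerm A B I J
matchingColumnCount≡formulaTerm A B I J with ≤-total I J
... | inj₁ I≤J = matchingColumnCount≡formulaTerm-≤ A B I≤J
... | inj₂ J≤I = matchingColumnCount≡formulaTerm-≥ A B J≤I

sumFin-cong : ∀ n {f g : Fin n → ℤ} → (∀ i → f i ≡ g i) → sumFin n f ≡ sumFin n g
sumFin-cong zero    _   = refl
sumFin-cong (suc n) f≗g = cong₂ _+_ (f≗g F.zero) (sumFin-cong n (f≗g ∘ F.suc))

sumFin-distrib-+ : ∀ n (f g : Fin n → ℤ) → sumFin n f + sumFin n g ≡ sumFin n (λ i → f i + g i)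
sumFin-distrib-+ zero    f g = refl
sumFin-distrib-+ (suc n) f g =
  trans (interchange (f F.zero) (sumFin n (f ∘ F.suc)) (g F.zero) (sumFin n (g ∘ F.suc)))
        (cong (_+_ (f F.zero + g F.zero)) (sumFin-distrib-+ n (f ∘ F.suc) (g ∘ F.suc)))
  where
  interchange : ∀ a b c d → a + b + (c + d) ≡ a + c + (b + d)
  interchange = solve-∀

sumPairs-cong : ∀ k {f g : Fin k → Fin k → ℤ} → (∀ a b → f a b ≡ g a b) → sumPairs k f ≡ sumPairs k g
sumPairs-cong k f≗g =
  sumFin-cong k λ a → sumFin-cong k λ b → cong (λ z → if ⌊ a F.<? b ⌋ then z else + 0) (f≗g a b)

sumPairs-distrib-+ : ∀ k (f g : Fin k → Fin k → ℤ) →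
                     sumPairs k f + sumPairs k g ≡ sumPairs k (λ a b → f a b + g a b)
sumPairs-distrib-+ k f g =
  trans (sumFin-distrib-+ k _ _) (sumFin-cong k λ a →
  trans (sumFin-distrib-+ k _ _) (sumFin-cong k λ b → if-distrib ⌊ a F.<? b ⌋))
  where
  if-distrib : ∀ {x y} (c : Bool) →
               (if c then x else + 0) + (if c then y else + 0) ≡ (if c then x + y else + 0)
  if-distrib true  = refl
  if-distrib false = refl

module _ {k : ℕ} {p : Fin k → ℕ} (β : Tuple k p) where

  TriplesByRows : Set
  TriplesByRows = Σ[ a ∈ Fin k ] Σ[ b ∈ Fin k ] (a F.< b × Σ[ i ∈ Fin (p a) ] Σ[ j ∈ Fin (p b) ]
                    Σ ℤ (MatchingColumn (lookup (β a) i) (lookup (β b) j) (row i) (row j)))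

  triples↔triplesByRows : Triples β ↔ TriplesByRows
  triples↔triplesByRows = mk↔ₛ′ to from (λ _ → refl) from∘to
    where
    to : Triples β → TriplesByRows
    to (a , b , _ , (_ , cv) , _ , a<b , (i , refl , cv-range) , (j , c , refl , refl , e , c-range)) =
      a , b , a<b , i , j , cv , cv-range , c , e , c-range
    from : TriplesByRows → Triples β
    from (a , b , a<b , i , j , cv , cv-range , c , e , c-range) =
      a , b , (row j , c - + 1) , (row i , cv) , (row j , c) ,
      a<b , (i , refl , cv-range) , (j , c , refl , refl , e , c-range)
    from∘to : ∀ t → from (to t) ≡ t
    from∘to (_ , _ , _ , _ , _ , _ , (_ , refl , _) , (_ , _ , refl , refl , _)) = refl

  tripleCount : ℤ
  tripleCount = sumPairs k λ a b → sumFin (p a) λ i → sumFin (p b) λ j →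
    matchingColumnCount (lookup (β a) i) (lookup (β b) j) (row i) (row j)

  counted-triplesByRows : Counted TriplesByRows tripleCount
  counted-triplesByRows =
    counted-Σ-Fin k λ a → counted-Σ-Fin k λ b → counted-guard (a F.<? b) FP.<-irrelevant
      (counted-Σ-Fin (p a) λ i → counted-Σ-Fin (p b) λ j → counted-matchingColumns _ _ _ _)

  countTerm+maxTerm≡tripleCount : countTerm β + maxTerm β ≡ tripleCount
  countTerm+maxTerm≡tripleCount = trans (sumPairs-distrib-+ k _ _) (sumPairs-cong k λ a b →
    trans (sumFin-distrib-+ (p a) _ _) (sumFin-cong (p a) λ i →
    trans (sumFin-distrib-+ (p b) _ _) (sumFin-cong (p b) λ j →
    sym (matchingColumnCount≡formulaTerm (lookup (β a) i) (lookup (β b) j) (row i) (row j)))))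

proposition5p2 : (k : ℕ) (p : Fin k → ℕ) (β : Tuple k p) →
    ((a : Fin k) → IsPartition (β a)) →
    ∃[ m ] ((Fin m ↔ Triples β) × (+ m ≡ countTerm β + maxTerm β))
proposition5p2 k p β _ =
  counted-≡ (sym (countTerm+maxTerm≡tripleCount β))
            (counted-↔ (↔-sym (triples↔triplesByRows β)) (counted-triplesByRows β))
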